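{- For every integer $k\ge 1$, the path $P_{2^{k-1}+1}$ on $2^{k-1}+1$ vertices is $k$-$cfc$-critical.
   Context: For an edge-colored graph, a path is conflict-free if some color occurs on exactly one of its edges; $cfc(G)$ is the minimum number of colors in an edge-coloring of the connected graph $G$ in which every pair of distinct vertices is joined by a conflict-free path. A nontrivial tree $T$ is $cfc$-critical if for every edge $e$ of $T$, every nontrivial component $T'$ of $T-e$ satisfies $cfc(T')<cfc(T)$; it is $k$-$cfc$-critical if in addition $cfc(T)=k$. -}

module Defs where

open import Level using (0ℓ)
open import Data.Nat using (ℕ; zero; suc; _<_)
open import Data.Fin using (Fin; toℕ; _≟_)
open import Data.List using (List; []; _∷_; _++_; [_])
open import Data.List.Relation.Unary.Linked using (Linked)
open import Data.List.Relation.Unary.Unique.Propositional using (Unique)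
open import Data.Product using (Σ; ∃; ∃-syntax; _×_; _,_)
open import Data.Sum using (_⊎_)
open import Data.Unit using (⊤)
open import Relation.Nullary using (¬_; yes; no)
open import Relation.Binary.PropositionalEquality using (_≡_; _≢_)

record Graph (V : Set) : Set₁ where
  field
    Vtx : V → Set
    Adj : V → V → Set
open Graph public

PathGraph : (n : ℕ) → Graph (Fin n)
Vtx (PathGraph n) _ = ⊤
Adj (PathGraph n) i j = (toℕ j ≡ suc (toℕ i)) ⊎ (toℕ i ≡ suc (toℕ j))

IsPath : {V : Set} → Graph V → List V → Set
IsPath G vs = Linked (Adj G) vs × Unique vs

-- Edge-colourings with (at most) c colours: a symmetric colour assignment to pairs.
Colouring : Set → ℕ → Set
Colouring V c = Σ (V → V → Fin c) λ col → ∀ x y → col x y ≡ col y x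

edgeColours : {V : Set} {c : ℕ} → (V → V → Fin c) → List V → List (Fin c)
edgeColours col (x ∷ y ∷ rest) = col x y ∷ edgeColours col (y ∷ rest)
edgeColours col _ = []

occurrences : {c : ℕ} → Fin c → List (Fin c) → ℕ
occurrences a [] = 0
occurrences a (b ∷ bs) with a ≟ b
... | yes _ = suc (occurrences a bs)
... | no _ = occurrences a bs

ConflictFree : {V : Set} {c : ℕ} → (V → V → Fin c) → List V → Set
ConflictFree {c = c} col vs = ∃[ a ] occurrences {c} a (edgeColours col vs) ≡ 1

CFConnecting : {V : Set} {c : ℕ} → Graph V → (V → V → Fin c) → Set
CFConnecting G col = ∀ x y → Vtx G x → Vtx G y → x ≢ y →
  ∃[ ms ] (IsPath G (x ∷ ms ++ [ y ]) × ConflictFree col (x ∷ ms ++ [ y ]))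

HasCFColouring : {V : Set} → Graph V → ℕ → Set
HasCFColouring {V} G c = Σ (Colouring V c) λ { (col , _) → CFConnecting G col }

CfcIs : {V : Set} → Graph V → ℕ → Set
CfcIs G k = HasCFColouring G k × (∀ m → m < k → ¬ HasCFColouring G m)

data Reach {V : Set} (G : Graph V) : V → V → Set where
  here : ∀ {x} → Vtx G x → Reach G x x
  step : ∀ {x y z} → Vtx G x → Adj G x y → Reach G y z → Reach G x z

Connected : {V : Set} → Graph V → Set
Connected G = ∀ x y → Vtx G x → Vtx G y → Reach G x y

Acyclic : {V : Set} → Graph V → Set
Acyclic G = ∀ x m ms y → IsPath G (x ∷ m ∷ ms ++ [ y ]) → ¬ Adj G y x

Tree : {V : Set} → Graph V → Set
Tree G = Connected G × Acyclic G

Nontrivial : {V : Set} → Graph V → Set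
Nontrivial G = ∃[ x ] ∃[ y ] (Vtx G x × Vtx G y × x ≢ y)

deleteEdge : {V : Set} → Graph V → V → V → Graph V
Vtx (deleteEdge G u v) = Vtx G
Adj (deleteEdge G u v) x y =
  Adj G x y × ¬ ((x ≡ u × y ≡ v) ⊎ (x ≡ v × y ≡ u))

component : {V : Set} → Graph V → V → Graph V
Vtx (component G w) x = Reach G w x
Adj (component G w) x y = Reach G w x × Adj G x y

CfcCritical : {V : Set} → Graph V → ℕ → Set
CfcCritical T k =
  Tree T × Nontrivial T × CfcIs T k ×
  (∀ u v → Adj T u v → ∀ w → Vtx T w →
     Nontrivial (component (deleteEdge T u v) w) →
     ∃[ k' ] (k' < k × CfcIs (component (deleteEdge T u v) w) k'))

module Submission where

-- The path P_{M+1} (vertices 0, …, M) has cfc-value the least c with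
-- M < 2 ^ c.  This gives the proposition: P_{2^(k-1)+1} has cfc-value k, and
-- deleting an edge leaves paths with fewer than 2 ^ (k-1) edges, of cfc < k.
--
-- The cfc-value of a path is a statement about words.  Number the edges of
-- the path lo, …, hi by lo, …, hi - 1 and read a colouring as a word h.
-- Paths of a path graph are monotone, so the only path between vertices
-- x < y reads the window h x, …, h (y - 1): the colouring is conflict-free
-- exactly when h is distinctive, i.e. every nonempty window has a singular
-- letter, one occurring once in it.
--  * Lower bound: splitting a distinctive word at a singular letter of the
--    whole word leaves two distinctive words without that letter, so a
--    distinctive word over c letters has length < 2 ^ c.
--  * Upper bound: the ruler word 0 1 0 2 0 1 0 3 … is distinctive, and its
--    first 2 ^ c - 1 letters use c letters.

open import Defs
open import Data.Nat using (ℕ; zero; suc; pred; _+_; _∸_; _^_; _≤_; _<_; _≤?_; _<?_; _⊓_; z≤n; s≤s; z<s; NonZero)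
open import Data.Nat.Properties
open import Data.Nat.DivMod using (_mod_; m<n⇒m%n≡m)
open import Data.Fin as Fin using (Fin; toℕ)
open import Data.Fin.Properties using (toℕ-injective; toℕ-fromℕ<; toℕ<n)
open import Data.List using (List; []; _∷_; _++_; [_]; length; filter; allFin; reverse)
open import Data.List.Base using (reverseAcc)
open import Data.List.Properties using (filter-notAll; length-tabulate; length-reverse; unfold-reverse; reverse-++)
open import Data.List.Membership.Propositional using (_∈_)
open import Data.List.Membership.Propositional.Properties using (∈-filter⁺; ∈-allFin)
import Data.List.Relation.Unary.Any as Any
open import Data.List.Relation.Unary.All using (_∷_)
import Data.List.Relation.Unary.AllPairs as AllPairs
open import Data.List.Relation.Unary.AllPairs using (_∷_)
open import Data.List.Relation.Unary.Linked as Linked using (Linked; []; [-]; _∷_)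
open import Data.List.Relation.Unary.Linked.Properties using (Linked⇒AllPairs)
open import Data.List.Relation.Unary.Unique.Propositional using (Unique)
open import Data.List.Relation.Binary.Permutation.Propositional using (↭⇒↭ₛ; ↭-sym)
open import Data.List.Relation.Binary.Permutation.Propositional.Properties using (↭-reverse)
open import Data.List.Relation.Binary.Permutation.Setoid.Properties using (Unique-resp-↭)
open import Data.Product as Product using (∃-syntax; _×_; _,_; proj₁; proj₂)
open import Data.Sum as Sum using (_⊎_; inj₁; inj₂)
open import Data.Unit using (tt)
open import Data.Empty using (⊥)
open import Function using (_∘_; flip)
open import Relation.Nullary using (¬_; Dec; yes; no; ¬?; contradiction)
open import Relation.Binary using (DecidableEquality; tri<; tri≈; tri>)
open import Relation.Binary.PropositionalEquality hiding ([_])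

toℕ-mod : ∀ {j n} .{{_ : NonZero n}} → j < n → toℕ (j mod n) ≡ j
toℕ-mod j<n = trans (toℕ-fromℕ< _) (m<n⇒m%n≡m j<n)

^-double : ∀ s → 2 ^ s + 2 ^ s ≡ 2 ^ suc s
^-double s = cong (2 ^ s +_) (sym (+-identityʳ (2 ^ s)))

search-below : ∀ {Q : ℕ → Set} → (∀ n → Dec (Q n)) → ∀ n →
  (∃[ m ] (m < n × Q m × ∀ k → k < m → ¬ Q k)) ⊎ (∀ k → k < n → ¬ Q k)
search-below Q? zero = inj₂ λ _ ()
search-below Q? (suc n) with search-below Q? n | Q? n
... | inj₁ (m , m<n , qm , smaller) | _ = inj₁ (m , m<n⇒m<1+n m<n , qm , smaller)
... | inj₂ none | yes qn = inj₁ (n , ≤-refl , qn , none)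
... | inj₂ none | no ¬qn = inj₂ λ k k<1+n →
  Sum.[ none k , (λ { refl → ¬qn }) ] (m≤n⇒m<n∨m≡n (≤-pred k<1+n))

least-witness : ∀ {Q : ℕ → Set} → (∀ n → Dec (Q n)) → ∀ {n} → Q n →
                ∃[ m ] (m ≤ n × Q m × ∀ k → k < m → ¬ Q k)
least-witness Q? {n} qn with search-below Q? (suc n)
... | inj₁ (m , m<1+n , qm , smaller) = m , ≤-pred m<1+n , qm , smaller
... | inj₂ none = contradiction qn (none n ≤-refl)

-- Words with singular letters

module _ {A : Set} where

  window : (ℕ → A) → ℕ → ℕ → List A
  window h x zero = []
  window h x (suc d) = h x ∷ window h (suc x) d

  SingularAt : (ℕ → A) → ℕ → ℕ → ℕ → Set
  SingularAt h x y p = x ≤ p × p < y × (∀ q → x ≤ q → q < y → h q ≡ h p → q ≡ p)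

  Singular : (ℕ → A) → ℕ → ℕ → Set
  Singular h x y = ∃[ p ] SingularAt h x y p

  Distinctive : (ℕ → A) → ℕ → ℕ → Set
  Distinctive h lo hi = ∀ x y → lo ≤ x → x < y → y ≤ hi → Singular h x y

  Letters : (ℕ → A) → ℕ → ℕ → List A → Set
  Letters h lo hi S = ∀ q → lo ≤ q → q < hi → h q ∈ S

  distinctive-sub : ∀ {h lo hi lo′ hi′} → Distinctive h lo hi →
                    lo ≤ lo′ → hi′ ≤ hi → Distinctive h lo′ hi′
  distinctive-sub dist lo≤lo′ hi′≤hi x y lo′≤x x<y y≤hi′ =
    dist x y (≤-trans lo≤lo′ lo′≤x) x<y (≤-trans y≤hi′ hi′≤hi)

  singular-shift : ∀ {h : ℕ → A} lo {x y} →
                   Singular (λ j → h (lo + j)) x y → Singular h (lo + x) (lo + y)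
  singular-shift {h} lo {x} {y} (p , x≤p , p<y , only) =
    lo + p , +-monoʳ-≤ lo x≤p , +-monoʳ-< lo p<y , only′
    where
    only′ : ∀ q → lo + x ≤ q → q < lo + y → h q ≡ h (lo + p) → q ≡ lo + p
    only′ q lo+x≤q q<lo+y eq with m≤n⇒∃[o]m+o≡n (≤-trans (m≤m+n lo x) lo+x≤q)
    ... | q′ , refl = cong (lo +_) (only q′ (+-cancelˡ-≤ lo _ _ lo+x≤q) (+-cancelˡ-< lo _ _ q<lo+y) eq)

singular-refine : ∀ {A B : Set} {f : ℕ → A} {g : ℕ → B} {x y} →
  (∀ q p → x ≤ q → q < y → x ≤ p → p < y → f q ≡ f p → g q ≡ g p) →
  Singular g x y → Singular f x y
singular-refine coarser (p , x≤p , p<y , only) =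
  p , x≤p , p<y , λ q x≤q q<y eq → only q x≤q q<y (coarser q p x≤q q<y x≤p p<y eq)

singular-cong : ∀ {A : Set} {f g : ℕ → A} {x y} →
  (∀ q → x ≤ q → q < y → f q ≡ g q) → Singular g x y → Singular f x y
singular-cong f≗g = singular-refine λ q p x≤q q<y x≤p p<y eq →
  trans (sym (f≗g q x≤q q<y)) (trans eq (f≗g p x≤p p<y))

-- Lower bound: a distinctive word over s letters has length < 2 ^ s

module _ {A : Set} (_≟_ : DecidableEquality A) where

  without : A → List A → List A
  without a = filter (λ b → ¬? (a ≟ b))

  no-letters : ∀ {a : A} S → length S ≤ 0 → ¬ a ∈ S
  no-letters [] _ ()

  -- Splitting at the singular position of the whole word leaves two
  -- distinctive words that avoid the singular letter.
  distinctive-bound : ∀ s S {h lo hi} → length S ≤ s →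
    Distinctive h lo hi → Letters h lo hi S → hi < lo + 2 ^ s
  distinctive-bound s S {h} {lo} {hi} size dist letters with hi ≤? lo
  ... | yes hi≤lo = ≤-<-trans hi≤lo (m<m+n lo (m^n>0 2 s))
  ... | no hi≰lo = split s size (dist lo hi ≤-refl (≰⇒> hi≰lo) ≤-refl)
    where
    split : ∀ s → length S ≤ s → Singular h lo hi → hi < lo + 2 ^ s
    split zero size (p , lo≤p , p<hi , _) =
      contradiction (letters p lo≤p p<hi) (no-letters S size)
    split (suc s′) size (p , lo≤p , p<hi , only) = begin-strict
      hi                     <⟨ right ⟩
      suc p + 2 ^ s′         ≤⟨ +-monoˡ-≤ (2 ^ s′) left ⟩
      lo + 2 ^ s′ + 2 ^ s′   ≡⟨ +-assoc lo _ _ ⟩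
      lo + (2 ^ s′ + 2 ^ s′) ≡⟨ cong (lo +_) (^-double s′) ⟩
      lo + 2 ^ suc s′        ∎
      where
      open ≤-Reasoning
      S′ : List A
      S′ = without (h p) S

      size′ : length S′ ≤ s′
      size′ = ≤-pred (≤-trans (filter-notAll _ S (Any.map (λ eq ne → ne eq)
                                                    (letters p lo≤p p<hi))) size)

      avoid : ∀ q → lo ≤ q → q < hi → q ≢ p → h q ∈ S′
      avoid q lo≤q q<hi q≢p = ∈-filter⁺ _ (letters q lo≤q q<hi)
                                λ eq → q≢p (only q lo≤q q<hi (sym eq))

      left : p < lo + 2 ^ s′
      left = distinctive-bound s′ S′ size′ (distinctive-sub dist ≤-refl (<⇒≤ p<hi))
               λ q lo≤q q<p → avoid q lo≤q (<-trans q<p p<hi) (<⇒≢ q<p)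

      right : hi < suc p + 2 ^ s′
      right = distinctive-bound s′ S′ size′
                (distinctive-sub dist (≤-trans lo≤p (n≤1+n p)) ≤-refl)
                λ q p<q q<hi → avoid q (≤-trans lo≤p (<⇒≤ p<q)) q<hi (≢-sym (<⇒≢ p<q))

distinctive-length : ∀ {c} {h : ℕ → Fin c} {lo hi} → Distinctive h lo hi → hi < lo + 2 ^ c
distinctive-length {c} dist = distinctive-bound Fin._≟_ c (allFin c)
  (≤-reflexive (length-tabulate _)) dist λ q _ _ → ∈-allFin _

-- Upper bound: the ruler word

-- ruler m is the word 0 1 0 2 0 1 0 … of length 2 ^ m - 1: two copies of
-- ruler (m - 1) around the new letter m - 1 at position 2 ^ (m - 1) - 1.
ruler : ℕ → ℕ → ℕ
ruler zero j = zero
ruler (suc m) j with <-cmp (suc j) (2 ^ m)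
... | tri< _ _ _ = ruler m j
... | tri≈ _ _ _ = m
... | tri> _ _ _ = ruler m (j ∸ 2 ^ m)

ruler-left : ∀ m {j} → suc j < 2 ^ m → ruler (suc m) j ≡ ruler m j
ruler-left m {j} lt with <-cmp (suc j) (2 ^ m)
... | tri< _ _ _ = refl
... | tri≈ _ eq _ = contradiction eq (<⇒≢ lt)
... | tri> _ _ gt = contradiction lt (<⇒≯ gt)

ruler-middle : ∀ m {j} → suc j ≡ 2 ^ m → ruler (suc m) j ≡ m
ruler-middle m {j} eq with <-cmp (suc j) (2 ^ m)
... | tri< lt _ _ = contradiction eq (<⇒≢ lt)
... | tri≈ _ _ _ = refl
... | tri> _ _ gt = contradiction (sym eq) (<⇒≢ gt)

ruler-right : ∀ m j → ruler (suc m) (2 ^ m + j) ≡ ruler m j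
ruler-right m j with <-cmp (suc (2 ^ m + j)) (2 ^ m)
... | tri< lt _ _ = contradiction lt (<-asym (s≤s (m≤m+n (2 ^ m) j)))
... | tri≈ _ eq _ = contradiction (sym eq) (<⇒≢ (s≤s (m≤m+n (2 ^ m) j)))
... | tri> _ _ _ = cong (ruler m) (m+n∸m≡n (2 ^ m) j)

right-half : ∀ m {j} → 2 ^ m < suc j → suc j < 2 ^ suc m → suc (j ∸ 2 ^ m) < 2 ^ m
right-half m {j} half<sj sj<full = begin-strict
  suc (j ∸ 2 ^ m) ≡⟨ +-∸-assoc 1 (≤-pred half<sj) ⟨
  suc j ∸ 2 ^ m   <⟨ m<n+o⇒m∸n<o (suc j) (2 ^ m) {{m^n≢0 2 m}}
                       (subst (suc j <_) (sym (^-double m)) sj<full) ⟩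
  2 ^ m           ∎
  where open ≤-Reasoning

ruler-bound : ∀ m {j} → suc j < 2 ^ m → ruler m j < m
ruler-bound zero (s≤s ())
ruler-bound (suc m) {j} sj<full with <-cmp (suc j) (2 ^ m)
... | tri< lt _ _ = m<n⇒m<1+n (ruler-bound m lt)
... | tri≈ _ _ _ = ≤-refl
... | tri> _ _ gt = m<n⇒m<1+n (ruler-bound m (right-half m gt sj<full))

ruler-off-middle : ∀ m {j} → suc j < 2 ^ suc m → suc j ≢ 2 ^ m → ruler (suc m) j < m
ruler-off-middle m {j} sj<full ¬mid with <-cmp (suc j) (2 ^ m)
... | tri< lt _ _ = ruler-bound m lt
... | tri≈ _ eq _ = contradiction eq ¬mid
... | tri> _ _ gt = ruler-bound m (right-half m gt sj<full)

-- Every nonempty window of ruler m is singular: it lies in one copy of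
-- ruler (m - 1), or it contains the middle letter m - 1, which occurs once.
ruler-singular : ∀ m {x y} → x < y → y < 2 ^ m → Singular (ruler m) x y
ruler-singular zero x<y (s≤s y≤0) = contradiction (≤-trans x<y y≤0) λ ()
ruler-singular (suc m) {x} {y} x<y y<full with y <? 2 ^ m | 2 ^ m ≤? x
... | yes y<half | _ = singular-cong (λ q _ q<y → ruler-left m (≤-<-trans q<y y<half))
                                    (ruler-singular m x<y y<half)
... | no _ | yes half≤x with m≤n⇒∃[o]m+o≡n half≤x | m≤n⇒∃[o]m+o≡n (≤-trans half≤x (<⇒≤ x<y))
...   | x′ , refl | y′ , refl = singular-shift (2 ^ m)
        (singular-cong (λ q _ _ → ruler-right m q)
          (ruler-singular m (+-cancelˡ-< (2 ^ m) _ _ x<y)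
            (+-cancelˡ-< (2 ^ m) _ _ (subst (2 ^ m + y′ <_) (sym (^-double m)) y<full))))
ruler-singular (suc m) {x} {y} x<y y<full | no y≮half | no half≰x =
  mid , <⇒≤pred (≰⇒> half≰x) , subst (_≤ y) (sym sm≡half) (≮⇒≥ y≮half) , only
  where
  mid : ℕ
  mid = pred (2 ^ m)
  sm≡half : suc mid ≡ 2 ^ m
  sm≡half = suc-pred (2 ^ m) {{m^n≢0 2 m}}

  only : ∀ q → x ≤ q → q < y → ruler (suc m) q ≡ ruler (suc m) mid → q ≡ mid
  only q _ q<y eq = by-cases (suc q ≟ 2 ^ m)
    where
    by-cases : Dec (suc q ≡ 2 ^ m) → q ≡ mid
    by-cases (yes sq≡half) = suc-injective (trans sq≡half (sym sm≡half))
    by-cases (no ¬mid) = contradiction (trans eq (ruler-middle m sm≡half))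
                           (<⇒≢ (ruler-off-middle m (≤-<-trans q<y y<full) ¬mid))

rulerWord : (c : ℕ) .{{_ : NonZero c}} → ℕ → ℕ → Fin c
rulerWord c lo j = ruler c (j ∸ lo) mod c

ruler-distinctive : ∀ c .{{_ : NonZero c}} lo hi → hi < lo + 2 ^ c →
                    Distinctive (rulerWord c lo) lo hi
ruler-distinctive c lo hi hi<top x y lo≤x x<y y≤hi
  with m≤n⇒∃[o]m+o≡n lo≤x | m≤n⇒∃[o]m+o≡n (≤-trans lo≤x (<⇒≤ x<y))
... | x′ , refl | y′ , refl =
  singular-shift lo (singular-refine coincide
    (ruler-singular c (+-cancelˡ-< lo _ _ x<y) y′<top))
  where
  y′<top : y′ < 2 ^ c
  y′<top = +-cancelˡ-< lo _ _ (≤-<-trans y≤hi hi<top)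

  letter : ∀ q → q < y′ → toℕ (rulerWord c lo (lo + q)) ≡ ruler c q
  letter q q<y′ = trans (cong (λ i → toℕ (ruler c i mod c)) (m+n∸m≡n lo q))
                        (toℕ-mod (ruler-bound c (≤-<-trans q<y′ y′<top)))

  coincide : ∀ q p → x′ ≤ q → q < y′ → x′ ≤ p → p < y′ →
             rulerWord c lo (lo + q) ≡ rulerWord c lo (lo + p) → ruler c q ≡ ruler c p
  coincide q p _ q<y′ _ p<y′ eq = trans (sym (letter q q<y′)) (trans (cong toℕ eq) (letter p p<y′))

module _ {c : ℕ} {h : ℕ → Fin c} where

  private
    shiftʳ : ∀ {q} x d → q < suc x + d → q < x + suc d
    shiftʳ {q} x d = subst (q <_) (sym (+-suc x d))

  occurrences-absent : ∀ {a} d x → (∀ q → x ≤ q → q < x + d → h q ≢ a) →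
                       occurrences a (window h x d) ≡ 0
  occurrences-absent zero x _ = refl
  occurrences-absent {a} (suc d) x absent with a Fin.≟ h x
  ... | yes a≡hx = contradiction (sym a≡hx) (absent x ≤-refl (m<m+n x z<s))
  ... | no _ = occurrences-absent d (suc x) λ q sx≤q q< →
                 absent q (<⇒≤ sx≤q) (shiftʳ x d q<)

  occurrences-zero : ∀ {a} d x → occurrences a (window h x d) ≡ 0 →
                     ∀ q → x ≤ q → q < x + d → h q ≢ a
  occurrences-zero zero x _ q x≤q q<x+0 =
    contradiction (≤-trans q<x+0 (≤-reflexive (+-identityʳ x))) (≤⇒≯ x≤q)
  occurrences-zero {a} (suc d) x none q x≤q q< with a Fin.≟ h x | m≤n⇒m<n∨m≡n x≤q
  ... | no a≢hx | inj₂ refl = a≢hx ∘ sym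
  ... | no _ | inj₁ x<q = occurrences-zero d (suc x) none q x<q (subst (q <_) (+-suc x d) q<)

  unique⇒singular : ∀ {a} d x → occurrences a (window h x d) ≡ 1 →
                    ∃[ p ] (SingularAt h x (x + d) p × h p ≡ a)
  unique⇒singular {a} (suc d) x once with a Fin.≟ h x
  ... | yes a≡hx = x , (≤-refl , m<m+n x z<s , only) , sym a≡hx
    where
    only : ∀ q → x ≤ q → q < x + suc d → h q ≡ h x → q ≡ x
    only q x≤q q< eq with m≤n⇒m<n∨m≡n x≤q
    ... | inj₂ x≡q = sym x≡q
    ... | inj₁ x<q = contradiction (trans eq (sym a≡hx))
          (occurrences-zero d (suc x) (suc-injective once) q x<q (subst (q <_) (+-suc x d) q<))
  ... | no a≢hx with unique⇒singular d (suc x) once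
  ...   | p , (x<p , p< , only) , hp≡a = p , (<⇒≤ x<p , shiftʳ x d p< , only′) , hp≡a
    where
    only′ : ∀ q → x ≤ q → q < x + suc d → h q ≡ h p → q ≡ p
    only′ q x≤q q< eq with m≤n⇒m<n∨m≡n x≤q
    ... | inj₂ refl = contradiction (sym (trans eq hp≡a)) a≢hx
    ... | inj₁ x<q = only q x<q (subst (q <_) (+-suc x d) q<) eq

  singular⇒unique : ∀ d x {p} → SingularAt h x (x + d) p → occurrences (h p) (window h x d) ≡ 1
  singular⇒unique zero x (x≤p , p<x+0 , _) =
    contradiction (≤-trans p<x+0 (≤-reflexive (+-identityʳ x))) (≤⇒≯ x≤p)
  singular⇒unique (suc d) x {p} (x≤p , p< , only) with h p Fin.≟ h x
  ... | yes hp≡hx = cong suc (occurrences-absent d (suc x) λ q x<q q< eq →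
          <⇒≢ x<q (sym (trans (only q (<⇒≤ x<q) (shiftʳ x d q<) eq) (sym x≡p))))
    where
    x≡p : x ≡ p
    x≡p = only x ≤-refl (m<m+n x z<s) (sym hp≡hx)
  ... | no hp≢hx = singular⇒unique d (suc x) (x<p , subst (p <_) (+-suc x d) p< , only′)
    where
    x<p : x < p
    x<p = ≤∧≢⇒< x≤p λ x≡p → hp≢hx (cong h (sym x≡p))
    only′ : ∀ q → suc x ≤ q → q < suc x + d → h q ≡ h p → q ≡ p
    only′ q x<q q< = only q (<⇒≤ x<q) (shiftʳ x d q<)

record _≃_ {V : Set} (G K : Graph V) : Set where
  field
    vtx-to   : ∀ {x} → Vtx G x → Vtx K x
    vtx-from : ∀ {x} → Vtx K x → Vtx G x
    adj-to   : ∀ {x y} → Adj G x y → Adj K x y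
    adj-from : ∀ {x y} → Adj K x y → Adj G x y

≃-sym : ∀ {V} {G K : Graph V} → G ≃ K → K ≃ G
≃-sym G≃K = record { vtx-to = vtx-from ; vtx-from = vtx-to ; adj-to = adj-from ; adj-from = adj-to }
  where open _≃_ G≃K

module _ {V : Set} where

  colouring-transport : ∀ {G K : Graph V} {c} → G ≃ K → HasCFColouring G c → HasCFColouring K c
  colouring-transport G≃K (colouring , connects) = colouring , λ x y vx vy x≢y →
    let (ms , (links , distinct) , cf) = connects x y (vtx-from vx) (vtx-from vy) x≢y
    in ms , (Linked.map adj-to links , distinct) , cf
    where open _≃_ G≃K

  cfc-transport : ∀ {G K : Graph V} {c} → G ≃ K → CfcIs G c → CfcIs K c
  cfc-transport G≃K (colourable , minimal) =
    colouring-transport G≃K colourable ,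
    λ m m<c K-colourable → minimal m m<c (colouring-transport (≃-sym G≃K) K-colourable)

  nontrivial-transport : ∀ {G K : Graph V} → G ≃ K → Nontrivial G → Nontrivial K
  nontrivial-transport G≃K (x , y , vx , vy , x≢y) = x , y , vtx-to vx , vtx-to vy , x≢y
    where open _≃_ G≃K

module _ {V : Set} {G : Graph V} where

  reach-snoc : ∀ {w x y} → Reach G w x → Adj G x y → Vtx G y → Reach G w y
  reach-snoc (here vx) xy vy = step vx xy (here vy)
  reach-snoc (step vw wz reach) xy vy = step vw wz (reach-snoc reach xy vy)

  reach-invariant : ∀ (Q : V → Set) → (∀ {x y} → Adj G x y → Q x → Q y) →
                    ∀ {w x} → Reach G w x → Q w → Q x
  reach-invariant Q preserved (here _) qw = qw
  reach-invariant Q preserved (step _ wz reach) qw =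
    reach-invariant Q preserved reach (preserved wz qw)

module _ {A : Set} where

  linked-reverse : ∀ {R : A → A → Set} {xs} → Linked R xs → Linked (flip R) (reverse xs)
  linked-reverse {R} {[]} [] = []
  linked-reverse {R} {x ∷ xs} links = go xs x [] links [-]
    where
    go : ∀ ys y acc → Linked R (y ∷ ys) → Linked (flip R) (y ∷ acc) →
         Linked (flip R) (reverseAcc (y ∷ acc) ys)
    go [] y acc _ done = done
    go (z ∷ zs) y acc (yz ∷ links) done = go zs z (y ∷ acc) links (yz ∷ done)

  unique-reverse : ∀ {xs : List A} → Unique xs → Unique (reverse xs)
  unique-reverse {xs} = Unique-resp-↭ (setoid A) (↭⇒↭ₛ (↭-sym (↭-reverse xs)))

  reverse-ends : ∀ (x : A) ms y → reverse (x ∷ ms ++ [ y ]) ≡ y ∷ reverse ms ++ [ x ]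
  reverse-ends x ms y rewrite unfold-reverse x (ms ++ [ y ]) | reverse-++ ms [ y ] = refl

module _ {V : Set} {c : ℕ} (col : V → V → Fin c) (col-sym : ∀ x y → col x y ≡ col y x) where

  edgeColours-reverse : ∀ xs → edgeColours col (reverse xs) ≡ reverse (edgeColours col xs)
  edgeColours-reverse [] = refl
  edgeColours-reverse (x ∷ xs) = go xs x []
    where
    go : ∀ ys y acc → edgeColours col (reverseAcc (y ∷ acc) ys) ≡
                      reverseAcc (edgeColours col (y ∷ acc)) (edgeColours col (y ∷ ys))
    go [] y acc = refl
    go (z ∷ zs) y acc rewrite go zs z (y ∷ acc) | col-sym z y = refl

occurrences-reverse : ∀ {c} (a : Fin c) xs → occurrences a (reverse xs) ≡ occurrences a xs
occurrences-reverse a xs = trans (go xs []) (+-identityʳ _)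
  where
  go : ∀ ys acc → occurrences a (reverseAcc acc ys) ≡ occurrences a ys + occurrences a acc
  go [] acc = refl
  go (y ∷ ys) acc rewrite go ys (y ∷ acc) with a Fin.≟ y
  ... | yes _ = +-suc _ _
  ... | no _ = refl

reverse-path : ∀ {V} {G : Graph V} {c} {col : V → V → Fin c} →
  (∀ {x y} → Adj G x y → Adj G y x) → (∀ x y → col x y ≡ col y x) → ∀ {x y} ms →
  IsPath G (y ∷ ms ++ [ x ]) × ConflictFree col (y ∷ ms ++ [ x ]) →
  IsPath G (x ∷ reverse ms ++ [ y ]) × ConflictFree col (x ∷ reverse ms ++ [ y ])
reverse-path {col = col} adj-sym col-sym {x} {y} ms ((links , distinct) , a , once)
  rewrite sym (reverse-ends y ms x) =
  (Linked.map adj-sym (linked-reverse links) , unique-reverse distinct) ,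
  a , trans (cong (occurrences a) (edgeColours-reverse col col-sym (y ∷ ms ++ [ x ])))
            (trans (occurrences-reverse a (edgeColours col (y ∷ ms ++ [ x ]))) once)

module OnPath (M : ℕ) where

  P : Graph (Fin (suc M))
  P = PathGraph (suc M)

  vertex : ℕ → Fin (suc M)
  vertex j = j mod suc M

  toℕ-vertex : ∀ {j} → j ≤ M → toℕ (vertex j) ≡ j
  toℕ-vertex j≤M = toℕ-mod (s≤s j≤M)

  vertex-toℕ : ∀ x → vertex (toℕ x) ≡ x
  vertex-toℕ x = toℕ-injective (toℕ-vertex (≤-pred (toℕ<n x)))

  Up : Fin (suc M) → Fin (suc M) → Set
  Up x y = toℕ y ≡ suc (toℕ x)

  up-vertex : ∀ {j} → suc j ≤ M → Up (vertex j) (vertex (suc j))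
  up-vertex sj≤M = trans (toℕ-vertex sj≤M) (cong suc (sym (toℕ-vertex (≤-trans (n≤1+n _) sj≤M))))

  Interval : ℕ → ℕ → Graph (Fin (suc M))
  Vtx (Interval lo hi) x = lo ≤ toℕ x × toℕ x ≤ hi
  Adj (Interval lo hi) x y = Vtx (Interval lo hi) x × Vtx (Interval lo hi) y × Adj P x y

  module _ {lo hi : ℕ} where

    interval-symmetric : ∀ {x y} → Adj (Interval lo hi) x y → Adj (Interval lo hi) y x
    interval-symmetric (vx , vy , xy) = vy , vx , Sum.swap xy

    vertex-in : ∀ {j} → lo ≤ j → j ≤ hi → hi ≤ M → Vtx (Interval lo hi) (vertex j)
    vertex-in lo≤j j≤hi hi≤M =
      subst (λ t → lo ≤ t × t ≤ hi) (sym (toℕ-vertex (≤-trans j≤hi hi≤M))) (lo≤j , j≤hi)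

    interval-edge : ∀ {j} → lo ≤ j → suc j ≤ hi → hi ≤ M → Adj (Interval lo hi) (vertex j) (vertex (suc j))
    interval-edge lo≤j sj≤hi hi≤M =
      vertex-in lo≤j (≤-trans (n≤1+n _) sj≤hi) hi≤M , vertex-in (≤-trans lo≤j (n≤1+n _)) sj≤hi hi≤M ,
      inj₁ (up-vertex (≤-trans sj≤hi hi≤M))

    interval-nontrivial : Nontrivial (Interval lo hi) → lo < hi
    interval-nontrivial (x , y , (lo≤x , x≤hi) , (lo≤y , y≤hi) , x≢y) with lo <? hi
    ... | yes lo<hi = lo<hi
    ... | no lo≮hi =
      contradiction (toℕ-injective (trans (squeeze lo≤x x≤hi) (sym (squeeze lo≤y y≤hi)))) x≢y
      where
      squeeze : ∀ {t} → lo ≤ t → t ≤ hi → t ≡ lo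
      squeeze lo≤t t≤hi = ≤-antisym (≤-trans t≤hi (≮⇒≥ lo≮hi)) lo≤t

  interval≃path : Interval 0 M ≃ P
  interval≃path = record
    { vtx-to = λ _ → tt ; vtx-from = λ {x} _ → everywhere x
    ; adj-to = proj₂ ∘ proj₂ ; adj-from = λ {x} {y} xy → everywhere x , everywhere y , xy }
    where
    everywhere : ∀ x → Vtx (Interval 0 M) x
    everywhere x = z≤n , ≤-pred (toℕ<n x)

  path-nontrivial : 0 < M → Nontrivial P
  path-nontrivial 0<M = vertex 0 , vertex 1 , tt , tt ,
    λ eq → 0≢1+n (trans (sym (toℕ-vertex z≤n)) (trans (cong toℕ eq) (toℕ-vertex 0<M)))

  chain : ℕ → ℕ → List (Fin (suc M))
  chain a zero = [ vertex a ]
  chain a (suc d) = vertex a ∷ chain (suc a) d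

  chain-ends : ∀ a d → ∃[ ms ] chain a (suc d) ≡ vertex a ∷ ms ++ [ vertex (a + suc d) ]
  chain-ends a zero = [] , cong (λ j → vertex a ∷ [ vertex j ]) (+-comm 1 a)
  chain-ends a (suc d) with chain-ends (suc a) d
  ... | ms , eq = vertex (suc a) ∷ ms ,
    cong (vertex a ∷_) (trans eq (cong (λ j → vertex (suc a) ∷ ms ++ [ vertex j ])
                                       (sym (+-suc a (suc d)))))

  climbing-unique : ∀ {L} → Linked Up L → Unique L
  climbing-unique ups = AllPairs.map (λ lt eq → <-irrefl (cong toℕ eq) lt)
    (Linked⇒AllPairs <-trans (Linked.map (λ up → ≤-reflexive (sym up)) ups))

  chain-cons : ∀ {R : Fin (suc M) → Fin (suc M) → Set} a d →
               R (vertex a) (vertex (suc a)) → Linked R (chain (suc a) d) → Linked R (chain a (suc d))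
  chain-cons a zero first _ = first ∷ [-]
  chain-cons a (suc d) first rest = first ∷ rest

  chain-path : ∀ {lo hi} a d → lo ≤ a → a + d ≤ hi → hi ≤ M →
               Linked (Adj (Interval lo hi)) (chain a d) × Linked Up (chain a d)
  chain-path a zero _ _ _ = [-] , [-]
  chain-path {lo} {hi} a (suc d) lo≤a a+sd≤hi hi≤M =
    Product.map (chain-cons a d (interval-edge lo≤a sa≤hi hi≤M))
                (chain-cons a d (up-vertex (≤-trans sa≤hi hi≤M)))
                (chain-path (suc a) d (≤-trans lo≤a (n≤1+n a)) sa+d≤hi hi≤M)
    where
    sa+d≤hi : suc a + d ≤ hi
    sa+d≤hi = subst (_≤ hi) (+-suc a d) a+sd≤hi
    sa≤hi : suc a ≤ hi
    sa≤hi = ≤-trans (m≤m+n (suc a) d) sa+d≤hi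

  monotone : ∀ L → Linked (Adj P) L → Unique L → Linked Up L ⊎ Linked (flip Up) L
  monotone [] _ _ = inj₁ []
  monotone (x ∷ []) _ _ = inj₁ [-]
  monotone (x ∷ y ∷ []) (move ∷ _) _ = Sum.map (_∷ [-]) (_∷ [-]) move
  monotone (x ∷ y ∷ z ∷ L) (move ∷ moves) ((_ ∷ x≢z ∷ _) ∷ distinct)
    with monotone (y ∷ z ∷ L) moves distinct | move
  ... | inj₁ ups | inj₁ up = inj₁ (up ∷ ups)
  ... | inj₂ downs | inj₂ down = inj₂ (down ∷ downs)
  ... | inj₁ (up ∷ _) | inj₂ down = contradiction (toℕ-injective (trans down (sym up))) x≢z
  ... | inj₂ (down ∷ _) | inj₁ up = contradiction (toℕ-injective (suc-injective (trans (sym up) down))) x≢z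

  climbing : ∀ x ms y → Linked Up (x ∷ ms ++ [ y ]) →
             (x ∷ ms ++ [ y ] ≡ chain (toℕ x) (suc (length ms))) × toℕ y ≡ toℕ x + suc (length ms)
  climbing x [] y (up ∷ [-]) =
    cong₂ (λ u v → u ∷ [ v ]) (sym (vertex-toℕ x)) (trans (sym (vertex-toℕ y)) (cong vertex up)) ,
    trans up (+-comm 1 (toℕ x))
  climbing x (m ∷ ms) y (up ∷ ups) with climbing m ms y ups
  ... | path≡ , top≡ =
    cong₂ _∷_ (sym (vertex-toℕ x)) (trans path≡ (cong (λ j → chain j (suc (length ms))) up)) ,
    trans top≡ (trans (cong (_+ suc (length ms)) up) (sym (+-suc (toℕ x) (suc (length ms)))))

  path-climbs : ∀ x ms y → Linked (Adj P) (x ∷ ms ++ [ y ]) → Unique (x ∷ ms ++ [ y ]) →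
                Linked Up (x ∷ ms ++ [ y ]) ⊎ Linked Up (y ∷ reverse ms ++ [ x ])
  path-climbs x ms y steps distinct with monotone _ steps distinct
  ... | inj₁ ups = inj₁ ups
  ... | inj₂ downs = inj₂ (subst (Linked Up) (reverse-ends x ms y) (linked-reverse downs))

  far-apart : ∀ {x y} l → toℕ y ≡ toℕ x + suc (suc l) → ¬ Adj P y x
  far-apart {x} {y} l far (inj₁ x≡sy) =
    m≢1+m+n (toℕ x) (trans x≡sy (cong suc far))
  far-apart {x} {y} l far (inj₂ y≡sx) =
    m≢1+m+n (toℕ x) (trans (suc-injective (trans (sym y≡sx) (trans far (+-suc (toℕ x) (suc l)))))
                           (+-suc (toℕ x) l))

  path-acyclic : Acyclic P
  path-acyclic x m ms y (steps , distinct) with path-climbs x (m ∷ ms) y steps distinct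
  ... | inj₁ ups = far-apart (length ms) (proj₂ (climbing x (m ∷ ms) y ups))
  ... | inj₂ ups = far-apart (length ms)
        (trans (proj₂ (climbing y (reverse (m ∷ ms)) x ups))
               (cong (λ l → toℕ y + suc l) (length-reverse (m ∷ ms)))) ∘ Sum.swap

  module Walk (G : Graph (Fin (suc M))) {lo hi : ℕ} (hi≤M : hi ≤ M)
              (vertices : ∀ {x} → Vtx (Interval lo hi) x → Vtx G x)
              (edges : ∀ {x y} → Adj (Interval lo hi) x y → Adj G x y) where

    walk-up : ∀ a d → lo ≤ a → a + d ≤ hi → Reach G (vertex a) (vertex (a + d))
    walk-up a zero lo≤a a≤hi =
      subst (Reach G (vertex a) ∘ vertex) (sym (+-identityʳ a))
            (here (vertices (vertex-in lo≤a (subst (_≤ hi) (+-identityʳ a) a≤hi) hi≤M)))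
    walk-up a (suc d) lo≤a a+sd≤hi =
      step (vertices (vertex-in lo≤a (≤-trans (m≤m+n a (suc d)) a+sd≤hi) hi≤M))
           (edges (interval-edge lo≤a (≤-trans (m≤m+n (suc a) d) sa+d≤hi) hi≤M))
           (subst (Reach G (vertex (suc a)) ∘ vertex) (sym (+-suc a d))
                  (walk-up (suc a) d (≤-trans lo≤a (n≤1+n a)) sa+d≤hi))
      where
      sa+d≤hi : suc a + d ≤ hi
      sa+d≤hi = subst (_≤ hi) (+-suc a d) a+sd≤hi

    walk-down : ∀ a d → lo ≤ a → a + d ≤ hi → Reach G (vertex (a + d)) (vertex a)
    walk-down a zero lo≤a a≤hi =
      subst (λ j → Reach G (vertex j) (vertex a)) (sym (+-identityʳ a))
            (here (vertices (vertex-in lo≤a (subst (_≤ hi) (+-identityʳ a) a≤hi) hi≤M)))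
    walk-down a (suc d) lo≤a a+sd≤hi =
      subst (λ j → Reach G (vertex j) (vertex a)) (sym (+-suc a d))
        (step (vertices (vertex-in (≤-trans lo≤a (≤-trans (m≤m+n a d) (n≤1+n _))) sa+d≤hi hi≤M))
              (edges (interval-symmetric (interval-edge (≤-trans lo≤a (m≤m+n a d)) sa+d≤hi hi≤M)))
              (walk-down a d lo≤a (≤-trans (n≤1+n _) sa+d≤hi)))
      where
      sa+d≤hi : suc (a + d) ≤ hi
      sa+d≤hi = subst (_≤ hi) (+-suc a d) a+sd≤hi

    interval-reach : ∀ {x y} → Vtx (Interval lo hi) x → Vtx (Interval lo hi) y → Reach G x y
    interval-reach {x} {y} (lo≤x , x≤hi) (lo≤y , y≤hi) with ≤-total (toℕ x) (toℕ y)
    ... | inj₁ x≤y with m≤n⇒∃[o]m+o≡n x≤y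
    ...   | d , x+d≡y = subst₂ (Reach G) (vertex-toℕ x) (trans (cong vertex x+d≡y) (vertex-toℕ y))
                          (walk-up (toℕ x) d lo≤x (subst (_≤ hi) (sym x+d≡y) y≤hi))
    interval-reach {x} {y} (lo≤x , x≤hi) (lo≤y , y≤hi) | inj₂ y≤x with m≤n⇒∃[o]m+o≡n y≤x
    ...   | d , y+d≡x = subst₂ (Reach G) (trans (cong vertex y+d≡x) (vertex-toℕ x)) (vertex-toℕ y)
                          (walk-down (toℕ y) d lo≤y (subst (_≤ hi) (sym y+d≡x) x≤hi))

  path-tree : Tree P
  path-tree = (λ x y _ _ → interval-reach (everywhere x) (everywhere y)) , path-acyclic
    where
    open _≃_ interval≃path
    open Walk P ≤-refl (λ _ → tt) adj-to
    everywhere : ∀ x → Vtx (Interval 0 M) x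
    everywhere x = vtx-from tt

  -- Conflict-free colourings of intervals are distinctive edge words

  edgeWord : ∀ {c} → (Fin (suc M) → Fin (suc M) → Fin c) → ℕ → Fin c
  edgeWord col j = col (vertex j) (vertex (suc j))

  edgeColours-chain : ∀ {c} (col : Fin (suc M) → Fin (suc M) → Fin c) a d →
                      edgeColours col (chain a d) ≡ window (edgeWord col) a d
  edgeColours-chain col a zero = refl
  edgeColours-chain col a (suc zero) = refl
  edgeColours-chain col a (suc (suc d)) = cong (edgeWord col a ∷_) (edgeColours-chain col (suc a) (suc d))

  climbing-singular : ∀ {c} (col : Fin (suc M) → Fin (suc M) → Fin c) {x y} ms →
    Linked Up (x ∷ ms ++ [ y ]) → ConflictFree col (x ∷ ms ++ [ y ]) →
    Singular (edgeWord col) (toℕ x) (toℕ y)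
  climbing-singular col {x} {y} ms ups (a , once) with climbing x ms y ups
  ... | path≡ , top≡ with unique⇒singular {h = edgeWord col} {a = a} (suc (length ms)) (toℕ x)
        (trans (cong (occurrences a) (trans (sym (edgeColours-chain col (toℕ x) (suc (length ms))))
                                            (cong (edgeColours col) (sym path≡)))) once)
  ...   | p , singular , _ = subst (Singular (edgeWord col) (toℕ x)) (sym top≡) (p , singular)

  interval-bound : ∀ {lo hi c} → hi ≤ M → HasCFColouring (Interval lo hi) c → hi < lo + 2 ^ c
  interval-bound {lo} {hi} hi≤M ((col , _) , connects) = distinctive-length distinctive
    where
    distinctive : Distinctive (edgeWord col) lo hi
    distinctive x y lo≤x x<y y≤hi = from-path (connects (vertex x) (vertex y) vx vy vx≢vy)
      where
      y≤M : y ≤ M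
      y≤M = ≤-trans y≤hi hi≤M
      x≤M : x ≤ M
      x≤M = ≤-trans (<⇒≤ x<y) y≤M
      vx : Vtx (Interval lo hi) (vertex x)
      vx = vertex-in lo≤x (≤-trans (<⇒≤ x<y) y≤hi) hi≤M
      vy : Vtx (Interval lo hi) (vertex y)
      vy = vertex-in (≤-trans lo≤x (<⇒≤ x<y)) y≤hi hi≤M
      vx≢vy : vertex x ≢ vertex y
      vx≢vy eq = <⇒≢ x<y (trans (sym (toℕ-vertex x≤M)) (trans (cong toℕ eq) (toℕ-vertex y≤M)))

      -- the path from x to y cannot descend, so it reads the window [x, y)
      from-path : ∃[ ms ] (IsPath (Interval lo hi) (vertex x ∷ ms ++ [ vertex y ]) ×
                           ConflictFree col (vertex x ∷ ms ++ [ vertex y ])) →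
                  Singular (edgeWord col) x y
      from-path (ms , (links , distinct) , cf)
        with path-climbs _ ms _ (Linked.map (proj₂ ∘ proj₂) links) distinct
      ... | inj₁ ups = subst₂ (Singular (edgeWord col)) (toℕ-vertex x≤M) (toℕ-vertex y≤M)
                         (climbing-singular col ms ups cf)
      ... | inj₂ ups = contradiction
              (subst₂ _<_ (toℕ-vertex y≤M)
                          (trans (sym (proj₂ (climbing _ (reverse ms) _ ups))) (toℕ-vertex x≤M))
                          (m<m+n _ z<s))
              (<⇒≯ x<y)

  -- Colouring the edge {j, j + 1} of P by the letter h j.
  edgeColouring : ∀ {c} → (ℕ → Fin c) → Colouring (Fin (suc M)) c
  edgeColouring h = (λ x y → h (toℕ x ⊓ toℕ y)) , λ x y → cong h (⊓-comm (toℕ x) (toℕ y))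

  edgeWord-edgeColouring : ∀ {c} (h : ℕ → Fin c) {j} → suc j ≤ M →
                           edgeWord (proj₁ (edgeColouring h)) j ≡ h j
  edgeWord-edgeColouring h sj≤M =
    cong h (trans (cong₂ _⊓_ (toℕ-vertex (≤-trans (n≤1+n _) sj≤M)) (toℕ-vertex sj≤M))
                  (m≤n⇒m⊓n≡m (n≤1+n _)))

  -- Upper bound: a distinctive word on [lo, hi) colours the interval
  -- conflict-free; the chain from x up to y reads a window of the word.
  interval-colourable : ∀ {lo hi c} {h : ℕ → Fin c} → hi ≤ M → Distinctive h lo hi →
                        HasCFColouring (Interval lo hi) c
  interval-colourable {lo} {hi} {c} {h} hi≤M distinctive = edgeColouring h , connects
    where
    col : Fin (suc M) → Fin (suc M) → Fin c
    col = proj₁ (edgeColouring h)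

    CFPath : Fin (suc M) → Fin (suc M) → Set
    CFPath x y = ∃[ ms ] (IsPath (Interval lo hi) (x ∷ ms ++ [ y ]) × ConflictFree col (x ∷ ms ++ [ y ]))

    chain-cf : ∀ a d → lo ≤ a → a + suc d ≤ hi → ConflictFree col (chain a (suc d))
    chain-cf a d lo≤a top≤hi
      with singular-cong (λ q _ q<top → edgeWord-edgeColouring h (≤-trans q<top (≤-trans top≤hi hi≤M)))
                         (distinctive a (a + suc d) lo≤a (m<m+n a z<s) top≤hi)
    ... | p , singularAt = edgeWord col p ,
          trans (cong (occurrences _) (edgeColours-chain col a (suc d)))
                (singular⇒unique (suc d) a singularAt)

    climb : ∀ {x y} → Vtx (Interval lo hi) x → Vtx (Interval lo hi) y → toℕ x < toℕ y → CFPath x y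
    climb {x} {y} (lo≤x , _) (_ , y≤hi) x<y with m≤n⇒∃[o]m+o≡n x<y
    ... | d , sx+d≡y with chain-ends (toℕ x) d
    ... | ms , chain≡ = ms , subst (λ L → IsPath (Interval lo hi) L × ConflictFree col L)
                                  (trans chain≡ ends≡)
                                  ((proj₁ path , climbing-unique (proj₂ path)) ,
                                   chain-cf (toℕ x) d lo≤x top≤hi)
      where
      x+sd≡y : toℕ x + suc d ≡ toℕ y
      x+sd≡y = trans (+-suc (toℕ x) d) sx+d≡y
      top≤hi : toℕ x + suc d ≤ hi
      top≤hi = subst (_≤ hi) (sym x+sd≡y) y≤hi
      ends≡ : vertex (toℕ x) ∷ ms ++ [ vertex (toℕ x + suc d) ] ≡ x ∷ ms ++ [ y ]
      ends≡ = cong₂ (λ u v → u ∷ ms ++ [ v ]) (vertex-toℕ x) (trans (cong vertex x+sd≡y) (vertex-toℕ y))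
      path : Linked (Adj (Interval lo hi)) (chain (toℕ x) (suc d)) × Linked Up (chain (toℕ x) (suc d))
      path = chain-path (toℕ x) (suc d) lo≤x top≤hi hi≤M

    connects : CFConnecting (Interval lo hi) col
    connects x y vx vy x≢y with <-cmp (toℕ x) (toℕ y)
    ... | tri< x<y _ _ = climb vx vy x<y
    ... | tri≈ _ x≡y _ = contradiction (toℕ-injective x≡y) x≢y
    ... | tri> _ _ y<x with climb vy vx y<x
    ...   | ms , path = reverse ms ,
            reverse-path {G = Interval lo hi} interval-symmetric (proj₂ (edgeColouring h)) ms path

  interval-cfc : ∀ {lo hi c} → lo < hi → hi ≤ M → hi < lo + 2 ^ c →
                 (∀ m → m < c → lo + 2 ^ m ≤ hi) → CfcIs (Interval lo hi) c
  interval-cfc {lo} {hi} {zero} lo<hi _ hi<lo+1 _ =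
    contradiction (≤-pred (subst (hi <_) (+-comm lo 1) hi<lo+1)) (<⇒≱ lo<hi)
  interval-cfc {lo} {hi} {suc c} lo<hi hi≤M hi<top below =
    interval-colourable hi≤M (ruler-distinctive (suc c) lo hi hi<top) ,
    λ m m<c colourable → <⇒≱ (interval-bound hi≤M colourable) (below m m<c)

  interval-cfc-below : ∀ {lo hi c₀} → lo < hi → hi ≤ M → hi < lo + 2 ^ c₀ →
                       ∃[ c ] (c ≤ c₀ × CfcIs (Interval lo hi) c)
  interval-cfc-below {lo} {hi} lo<hi hi≤M hi<top
    with least-witness (λ c → hi <? lo + 2 ^ c) hi<top
  ... | c , c≤c₀ , hi<lo+2^c , smaller =
    c , c≤c₀ , interval-cfc lo<hi hi≤M hi<lo+2^c λ m m<c → ≮⇒≥ (smaller m m<c)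

  -- Deleting an edge of P

  Cut : ℕ → Fin (suc M) → Fin (suc M) → Set
  Cut p x y = (toℕ x ≡ p × toℕ y ≡ suc p) ⊎ (toℕ y ≡ p × toℕ x ≡ suc p)

  edge-cut : ∀ {u v} → Adj P u v → ∃[ p ] Cut p u v
  edge-cut {u} {v} (inj₁ v≡su) = toℕ u , inj₁ (refl , v≡su)
  edge-cut {u} {v} (inj₂ u≡sv) = toℕ v , inj₂ (refl , u≡sv)

  same : ∀ {a b : Fin (suc M)} {n} → toℕ a ≡ n → toℕ b ≡ n → a ≡ b
  same a≡n b≡n = toℕ-injective (trans a≡n (sym b≡n))

  cut-top : ∀ {p u v} → Cut p u v → suc p ≤ M
  cut-top {v = v} (inj₁ (_ , v≡sp)) = subst (_≤ M) v≡sp (≤-pred (toℕ<n v))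
  cut-top {u = u} (inj₂ (_ , u≡sp)) = subst (_≤ M) u≡sp (≤-pred (toℕ<n u))

  cut-not-low : ∀ {p x y} → Cut p x y → toℕ x ≤ p → toℕ y ≤ p → ⊥
  cut-not-low {p} (inj₁ (_ , y≡sp)) _ y≤p = 1+n≰n (subst (_≤ p) y≡sp y≤p)
  cut-not-low {p} (inj₂ (_ , x≡sp)) x≤p _ = 1+n≰n (subst (_≤ p) x≡sp x≤p)

  cut-not-high : ∀ {p x y} → Cut p x y → p < toℕ x → p < toℕ y → ⊥
  cut-not-high (inj₁ (x≡p , _)) p<x _ = <-irrefl (sym x≡p) p<x
  cut-not-high (inj₂ (y≡p , _)) _ p<y = <-irrefl (sym y≡p) p<y

  cuts-agree : ∀ {p x y u v} → Cut p x y → Cut p u v → (x ≡ u × y ≡ v) ⊎ (x ≡ v × y ≡ u)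
  cuts-agree (inj₁ (x≡p , y≡sp)) (inj₁ (u≡p , v≡sp)) = inj₁ (same x≡p u≡p , same y≡sp v≡sp)
  cuts-agree (inj₁ (x≡p , y≡sp)) (inj₂ (v≡p , u≡sp)) = inj₂ (same x≡p v≡p , same y≡sp u≡sp)
  cuts-agree (inj₂ (y≡p , x≡sp)) (inj₁ (u≡p , v≡sp)) = inj₂ (same x≡sp v≡sp , same y≡p u≡p)
  cuts-agree (inj₂ (y≡p , x≡sp)) (inj₂ (v≡p , u≡sp)) = inj₁ (same x≡sp u≡sp , same y≡p v≡p)

  component≃interval : ∀ (G : Graph (Fin (suc M))) {w lo hi} → hi ≤ M →
    (∀ x → Vtx G x) → (∀ {x y} → Adj G x y → Adj P x y) →
    (∀ {x y} → Adj (Interval lo hi) x y → Adj G x y) →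
    Vtx (Interval lo hi) w → (∀ {x} → Reach G w x → Vtx (Interval lo hi) x) →
    component G w ≃ Interval lo hi
  component≃interval G hi≤M everywhere sub keeps w-in confined = record
    { vtx-to = confined
    ; vtx-from = interval-reach w-in
    ; adj-to = λ { (reach , xy) → confined reach , confined (reach-snoc reach xy (everywhere _)) , sub xy }
    ; adj-from = λ { xy@(vx , _ , _) → interval-reach w-in vx , keeps xy } }
    where open Walk G hi≤M (λ {x} _ → everywhere x) keeps

  module Deletion {p u v} (cut : Cut p u v) where

    G : Graph (Fin (suc M))
    G = deleteEdge P u v

    deleted-cut : ∀ {x y} → (x ≡ u × y ≡ v) ⊎ (x ≡ v × y ≡ u) → Cut p x y
    deleted-cut (inj₁ (refl , refl)) = cut
    deleted-cut (inj₂ (refl , refl)) = Sum.swap cut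

    stays-low : ∀ {x y} → Adj G x y → toℕ x ≤ p → toℕ y ≤ p
    stays-low (inj₂ x≡sy , _) x≤p = ≤-trans (n≤1+n _) (subst (_≤ p) x≡sy x≤p)
    stays-low (inj₁ y≡sx , kept) x≤p with m≤n⇒m<n∨m≡n x≤p
    ... | inj₁ x<p = subst (_≤ p) (sym y≡sx) x<p
    ... | inj₂ x≡p = contradiction (cuts-agree (inj₁ (x≡p , trans y≡sx (cong suc x≡p))) cut) kept

    stays-high : ∀ {x y} → Adj G x y → p < toℕ x → p < toℕ y
    stays-high (inj₁ y≡sx , _) p<x = subst (p <_) (sym y≡sx) (m<n⇒m<1+n p<x)
    stays-high (inj₂ x≡sy , kept) p<x with m≤n⇒m<n∨m≡n (≤-pred (subst (p <_) x≡sy p<x))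
    ... | inj₁ p<y = p<y
    ... | inj₂ p≡y =
      contradiction (cuts-agree (inj₂ (sym p≡y , trans x≡sy (cong suc (sym p≡y)))) cut) kept

    low-component : ∀ {w} → toℕ w ≤ p → component G w ≃ Interval 0 p
    low-component w≤p = component≃interval G (≤-trans (n≤1+n p) (cut-top cut)) (λ _ → tt) proj₁
      (λ { ((_ , x≤p) , (_ , y≤p) , xy) → xy , λ del → cut-not-low (deleted-cut del) x≤p y≤p })
      (z≤n , w≤p)
      (λ reach → z≤n , reach-invariant (λ x → toℕ x ≤ p) stays-low reach w≤p)

    high-component : ∀ {w} → p < toℕ w → component G w ≃ Interval (suc p) M
    high-component {w} p<w = component≃interval G ≤-refl (λ _ → tt) proj₁
      (λ { ((p<x , _) , (p<y , _) , xy) → xy , λ del → cut-not-high (deleted-cut del) p<x p<y })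
      (p<w , ≤-pred (toℕ<n w))
      (λ {x} reach → reach-invariant (λ x → p < toℕ x) stays-high reach p<w , ≤-pred (toℕ<n x))

  via-interval : ∀ {C : Graph (Fin (suc M))} {lo hi c₀} → C ≃ Interval lo hi → Nontrivial C →
                 (lo < hi → ∃[ c ] (c ≤ c₀ × CfcIs (Interval lo hi) c)) → ∃[ c ] (c ≤ c₀ × CfcIs C c)
  via-interval C≃I nontrivial interval-value
    with interval-value (interval-nontrivial (nontrivial-transport C≃I nontrivial))
  ... | c , c≤c₀ , cfc = c , c≤c₀ , cfc-transport (≃-sym C≃I) cfc

  component-cfc : ∀ {c₀} → M ≤ 2 ^ c₀ → ∀ {u v} → Adj P u v → ∀ w →
                  Nontrivial (component (deleteEdge P u v) w) →
                  ∃[ c ] (c ≤ c₀ × CfcIs (component (deleteEdge P u v) w) c)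
  component-cfc {c₀} M≤top uv w nontrivial with edge-cut uv
  ... | p , cut with toℕ w ≤? p
  ...   | yes w≤p = via-interval (Deletion.low-component cut w≤p) nontrivial λ 0<p →
          interval-cfc-below 0<p (≤-trans (n≤1+n p) (cut-top cut)) (≤-trans (cut-top cut) M≤top)
  ...   | no w≰p = via-interval (Deletion.high-component cut (≰⇒> w≰p)) nontrivial λ sp<M →
          interval-cfc-below sp<M ≤-refl (≤-<-trans M≤top (m<n+m _ z<s))

  path-cfc : ∀ {c} → 0 < M → M < 2 ^ c → (∀ m → m < c → 2 ^ m ≤ M) → CfcIs P c
  path-cfc 0<M M<top below = cfc-transport interval≃path (interval-cfc 0<M ≤-refl M<top below)

proposition4p2 : (k : ℕ) → 1 ≤ k → CfcCritical (PathGraph (2 ^ (k ∸ 1) + 1)) k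
proposition4p2 (suc k′) _ = subst (λ n → CfcCritical (PathGraph n) (suc k′)) (+-comm 1 (2 ^ k′))
  ( path-tree
  , path-nontrivial (m^n>0 2 k′)
  , path-cfc (m^n>0 2 k′) (^-monoʳ-< 2 (s≤s (s≤s z≤n)) (n<1+n k′)) (λ m m<k′+1 → ^-monoʳ-≤ 2 (≤-pred m<k′+1))
  , λ u v uv w _ nontrivial →
      let (c , c≤k′ , cfc) = component-cfc ≤-refl uv w nontrivial in c , s≤s c≤k′ , cfc )
  where open OnPath (2 ^ k′)
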